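{- Let $p$ be a prime and $r$ an integer with $p>r\geq1$. Let $\kappa_B\subset\kappa_C$ be fields of characteristic $p$, and let $D$ be a derivation of $\kappa_C[[q]]$ over $\kappa_B[[q]]$ which is $q$-integral (i.e. $v_q(D(\alpha))\geq v_q(\alpha)$ for all $\alpha$, where $v_q$ is the $q$-adic valuation) and satisfies $D^p=D$; extend $D$ to $\kappa_C((q))$ and let it act coordinatewise on $\kappa_C((q))^r$. Let $f_0,\dots,f_{r-1}\in\kappa_C((q))$ and let $A$ be the $r\times r$ companion matrix with ones on the subdiagonal, last column $(f_0,\dots,f_{r-1})^T$ and zeros elsewhere. Define $\nabla(D):\kappa_C((q))^r\to\kappa_C((q))^r$ by $\nabla(D)(v)=Av+D(v)$, and similarly $\nabla(D^p)(v)=Av+D^p(v)$. If some entry of $A$ has negative $q$-adic valuation, then $\nabla(D)^p\neq\nabla(D^p)$. -}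

module Defs where

open import Level using (Level; _⊔_)
open import Algebra.Bundles using (CommutativeRing)
open import Data.Nat as ℕ using (ℕ; zero; suc; _∸_; _≡ᵇ_)
open import Data.Integer as ℤ using (ℤ; +_; -[1+_])
open import Data.Fin using (Fin; toℕ) renaming (zero to fzero; suc to fsuc)
open import Data.Product using (∃; _×_; _,_)
open import Data.Bool using (if_then_else_)
open import Relation.Nullary using (¬_)

-- Everything is developed over a commutative ring K (playing the role of κ_C),
-- with its setoid equality _≈_.
module Over {c ℓ} (K : CommutativeRing c ℓ) where
  open CommutativeRing K using (Carrier; _≈_; _+_; _*_; -_; 0#; 1#)

  IsField : Set (c ⊔ ℓ)
  IsField = ¬ (1# ≈ 0#) × (∀ x → ¬ (x ≈ 0#) → ∃ λ y → x * y ≈ 1#)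

  natMul : ℕ → Carrier
  natMul zero    = 0#
  natMul (suc n) = 1# + natMul n

  HasCharacteristic : ℕ → Set ℓ
  HasCharacteristic p =
    natMul p ≈ 0# × (∀ n → 0 ℕ.< n → n ℕ.< p → ¬ (natMul n ≈ 0#))

  record IsSubfield {b} (B : Carrier → Set b) : Set (c ⊔ ℓ ⊔ b) where
    field
      respects : ∀ {x y} → x ≈ y → B x → B y
      0∈ : B 0#
      1∈ : B 1#
      +∈ : ∀ {x y} → B x → B y → B (x + y)
      -∈ : ∀ {x} → B x → B (- x)
      *∈ : ∀ {x y} → B x → B y → B (x * y)
      inv∈ : ∀ {x y} → B x → x * y ≈ 1# → B y

  PS : Set c
  PS = ℕ → Carrier

  _≈ₚ_ : PS → PS → Set ℓ
  s ≈ₚ t = ∀ n → s n ≈ t n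

  0ₚ : PS
  0ₚ _ = 0#

  1ₚ : PS
  1ₚ zero    = 1#
  1ₚ (suc _) = 0#

  _+ₚ_ : PS → PS → PS
  (s +ₚ t) n = s n + t n

  sumTo : (ℕ → Carrier) → ℕ → Carrier
  sumTo f zero    = f zero
  sumTo f (suc n) = sumTo f n + f (suc n)

  _*ₚ_ : PS → PS → PS
  (s *ₚ t) n = sumTo (λ i → s i * t (n ∸ i)) n

  qPow : ℕ → PS → PS
  qPow zero    s n       = s n
  qPow (suc k) s zero    = 0#
  qPow (suc k) s (suc n) = qPow k s n

  InB : ∀ {b} → (Carrier → Set b) → PS → Set b
  InB B s = ∀ n → B (s n)

  record IsDerivationOver {b} (B : Carrier → Set b) (D : PS → PS)
         : Set (c ⊔ ℓ ⊔ b) where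
    field
      cong     : ∀ {s t} → s ≈ₚ t → D s ≈ₚ D t
      additive : ∀ s t → D (s +ₚ t) ≈ₚ (D s +ₚ D t)
      linear   : ∀ β s → InB B β → D (β *ₚ s) ≈ₚ (β *ₚ D s)
      leibniz  : ∀ s t → D (s *ₚ t) ≈ₚ ((s *ₚ D t) +ₚ (D s *ₚ t))

  -- q-integrality: v_q(D α) ≥ v_q(α) for all α, written out as:
  -- whenever q^k divides α (first k coefficients vanish), q^k divides D α.
  QIntegral : (PS → PS) → Set (c ⊔ ℓ)
  QIntegral D = ∀ s k → (∀ i → i ℕ.< k → s i ≈ 0#)
                      → (∀ i → i ℕ.< k → D s i ≈ 0#)

  iterate : ∀ {a} {A : Set a} → (A → A) → ℕ → A → A
  iterate f zero    x = x
  iterate f (suc n) x = f (iterate f n x)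

  -- Laurent series K((q)) : elements q^{-den} · ser with ser ∈ K[[q]]

  record Laurent : Set c where
    constructor laurent
    field
      den : ℕ
      ser : PS
  open Laurent public

  -- q^{-a} s = q^{-b} t  iff  q^b s = q^a t in K[[q]]
  _≈ₗ_ : Laurent → Laurent → Set ℓ
  x ≈ₗ y = qPow (den y) (ser x) ≈ₚ qPow (den x) (ser y)

  0ₗ : Laurent
  0ₗ = laurent 0 0ₚ

  1ₗ : Laurent
  1ₗ = laurent 0 1ₚ

  _+ₗ_ : Laurent → Laurent → Laurent
  x +ₗ y = laurent (den x ℕ.+ den y) (qPow (den y) (ser x) +ₚ qPow (den x) (ser y))

  _*ₗ_ : Laurent → Laurent → Laurent
  x *ₗ y = laurent (den x ℕ.+ den y) (ser x *ₚ ser y)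

  -- coefficient of q^{-(m+1)} in q^{-a} s
  negCoeff : ℕ → PS → ℕ → Carrier
  negCoeff zero    s m       = 0#
  negCoeff (suc a) s zero    = s a
  negCoeff (suc a) s (suc m) = negCoeff a s m

  coeff : Laurent → ℤ → Carrier
  coeff x (+ n)      = ser x (n ℕ.+ den x)
  coeff x -[1+ m ]   = negCoeff (den x) (ser x) m

  NegativeValuation : Laurent → Set ℓ
  NegativeValuation x = ∃ λ (n : ℤ) → n ℤ.< ℤ.0ℤ × ¬ (coeff x n ≈ 0#)

  -- the (unique) extension of D from K[[q]] to K((q)) = K[[q]][q⁻¹]:
  -- D(q^{-a} s) = q^{-a} D(s)  (as D(q) = 0)
  extend : (PS → PS) → Laurent → Laurent
  extend D x = laurent (den x) (D (ser x))

  LVec : ℕ → Set c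
  LVec r = Fin r → Laurent

  LMat : ℕ → Set c
  LMat r = Fin r → Fin r → Laurent

  _≋_ : ∀ {r} → LVec r → LVec r → Set ℓ
  v ≋ w = ∀ i → v i ≈ₗ w i

  sumFin : ∀ {r} → (Fin r → Laurent) → Laurent
  sumFin {zero}  f = 0ₗ
  sumFin {suc r} f = f fzero +ₗ sumFin (λ i → f (fsuc i))

  matVec : ∀ {r} → LMat r → LVec r → LVec r
  matVec M v i = sumFin (λ j → M i j *ₗ v j)

  companion : (r : ℕ) → (Fin r → Laurent) → LMat r
  companion r f i j =
    if toℕ j ≡ᵇ (r ∸ 1) then f i
    else (if toℕ i ≡ᵇ suc (toℕ j) then 1ₗ else 0ₗ)

  connection : ∀ {r} → LMat r → (Laurent → Laurent) → LVec r → LVec r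
  connection A E v i = matVec A v i +ₗ E (v i)

module Submission where

-- Let S/R be the steepest slope of the Newton polygon of the companion polynomial, i.e. the least
-- rational s > 0 with v_q(f_i) ≥ -(r - i)·s for all i, and give coordinate i the weight i·s.
-- Multiplication by A then lowers weighted orders by at most s, and the part lowering them by exactly
-- s is a companion matrix L over κ_C with nonzero last column, which never kills e₀. Since D is
-- q-integral it lowers no order, so coordinate i of ∇(D)^p e₀ has order ≥ (i - p)·s with leading
-- coefficients L^p e₀ ≠ 0, whereas ∇(D^p) e₀ = A e₀ + D^p e₀ has order ≥ (i - 1)·s; for p ≥ 2 the two
-- differ. Equality in κ_C is
-- not decidable, but as the statement is a negation, the finitely many zero tests needed may be
-- assumed decided.

open import Defs
open import Algebra.Bundles using (CommutativeRing)
open import Data.Nat using (ℕ; _≤_; _<_)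
open import Data.Nat.Primality using (Prime; prime⇒nonTrivial)
open import Data.Fin using (Fin)
open import Data.Product using (∃; _×_)
open import Relation.Nullary using (¬_)

open import Level using (_⊔_)
open import Data.Bool using (true; false; if_then_else_; T)
open import Data.Vec.Functional using (removeAt)
open import Data.Empty using (⊥; ⊥-elim)
open import Data.Fin as Fin using (toℕ; fromℕ; fromℕ<; inject₁) renaming (zero to fzero; suc to fsuc)
import Data.Fin.Properties as Finₚ
open import Data.Integer as ℤ using (ℤ; +_; -[1+_]; _⊖_; 0ℤ)
import Data.Integer.Properties as ℤₚ
open import Data.Integer.Divisibility.Signed using (divides; _∣?_) renaming (_∣_ to _∣ℤ_)
open import Data.Integer.Tactic.RingSolver using (solve-∀)
open import Data.Nat as ℕ using (zero; suc; _∸_; _≡ᵇ_; z≤n; s≤s; NonZero; _!)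
open import Data.Nat.Properties using (_!≢0)
open import Data.Nat.Divisibility using (_∣_; ∣-trans; m∣m*n; m≤n⇒m!∣n!)
import Data.Nat.Properties as ℕₚ
open import Data.Product using (_,_; proj₁; proj₂)
open import Data.Sum using (_⊎_; inj₁; inj₂)
open import Function using (_∘_)
open import Relation.Binary.PropositionalEquality as ≡ using (_≡_; _≢_; cong)
open import Relation.Nullary using (Dec; yes; no; contradiction)
open import Relation.Nullary.Decidable using (¬¬-excluded-middle)

¬¬-Π-Fin : ∀ {n p} {P : Fin n → Set p} → (∀ i → ¬ ¬ P i) → ¬ ¬ (∀ i → P i)
¬¬-Π-Fin {zero}  _   k = k λ ()
¬¬-Π-Fin {suc n} ¬¬P k = ¬¬P fzero λ p₀ → ¬¬-Π-Fin (¬¬P ∘ fsuc) λ ps → k λ { fzero → p₀ ; (fsuc i) → ps i }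

least-tail-bound : ∀ {p} {P : ℕ → Set p} → (∀ t → Dec (P t)) → ∀ N → (∀ t → N ≤ t → P t)
                 → ∃ λ n → (∀ t → n ≤ t → P t) × (∀ u → n ≡ suc u → ¬ P u)
least-tail-bound P? zero    P-tail = 0 , P-tail , λ _ ()
least-tail-bound {P = P} P? (suc N) P-tail with P? N
... | yes PN = least-tail-bound P? N P-from-N
  where
  P-from-N : ∀ t → N ≤ t → P t
  P-from-N t N≤t with N ℕ.≟ t
  ... | yes ≡.refl = PN
  ... | no N≢t     = P-tail t (ℕₚ.≤∧≢⇒< N≤t N≢t)
... | no ¬PN = suc N , P-tail , λ { _ ≡.refl → ¬PN }

argmax : ∀ {n} (w : Fin (suc n) → ℕ) → ∃ λ i → ∀ j → w j ≤ w i
argmax {zero}  w = fzero , λ { fzero → ℕₚ.≤-refl }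
argmax {suc n} w with argmax (w ∘ fsuc)
... | i , w≤wi with w fzero ℕ.≤? w (fsuc i)
...   | yes w₀≤wi = fsuc i , λ { fzero → w₀≤wi ; (fsuc j) → w≤wi j }
...   | no w₀≰wi  = fzero , λ { fzero → ℕₚ.≤-refl
                                ; (fsuc j) → ℕₚ.≤-trans (w≤wi j) (ℕₚ.<⇒≤ (ℕₚ.≰⇒> w₀≰wi)) }

+-<-split : ∀ {a b c d} → a ℤ.+ b ℤ.< c ℤ.+ d → a ℤ.< c ⊎ b ℤ.< d
+-<-split {a} {b} {c} {d} a+b<c+d with a ℤ.<? c | b ℤ.<? d
... | yes a<c | _       = inj₁ a<c
... | no _    | yes b<d = inj₂ b<d
... | no a≮c  | no b≮d  =
  ⊥-elim (ℤₚ.<-irrefl ≡.refl (ℤₚ.≤-<-trans (ℤₚ.+-mono-≤ (ℤₚ.≮⇒≥ a≮c) (ℤₚ.≮⇒≥ b≮d)) a+b<c+d))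

+-≡-split : ∀ {a b c d} → a ℤ.+ b ≡ c ℤ.+ d → a ≢ c → a ℤ.< c ⊎ b ℤ.< d
+-≡-split {a} {b} {c} {d} a+b≡c+d a≢c with a ℤ.<? c | b ℤ.<? d
... | yes a<c | _       = inj₁ a<c
... | no _    | yes b<d = inj₂ b<d
... | no a≮c  | no b≮d  = ⊥-elim (ℤₚ.<⇒≢ c+d<a+b (≡.sym a+b≡c+d))
  where
  c+d<a+b : c ℤ.+ d ℤ.< a ℤ.+ b
  c+d<a+b = ℤₚ.+-mono-<-≤ (ℤₚ.≤∧≢⇒< (ℤₚ.≮⇒≥ a≮c) (a≢c ∘ ≡.sym)) (ℤₚ.≮⇒≥ b≮d)

last-or-inject₁ : ∀ {n} (j : Fin (suc n)) → j ≡ fromℕ n ⊎ ∃ λ j′ → j ≡ inject₁ j′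
last-or-inject₁ {zero}  fzero    = inj₁ ≡.refl
last-or-inject₁ {suc n} fzero    = inj₂ (fzero , ≡.refl)
last-or-inject₁ {suc n} (fsuc j) with last-or-inject₁ j
... | inj₁ j≡last        = inj₁ (cong fsuc j≡last)
... | inj₂ (j′ , j≡j′)   = inj₂ (fsuc j′ , cong fsuc j≡j′)

≡ᵇ-refl : ∀ n → (n ≡ᵇ n) ≡ true
≡ᵇ-refl zero    = ≡.refl
≡ᵇ-refl (suc n) = ≡ᵇ-refl n

≡ᵇ-true : ∀ {m n} → (m ≡ᵇ n) ≡ true → m ≡ n
≡ᵇ-true {m} {n} e = ℕₚ.≡ᵇ⇒≡ m n (≡.subst T (≡.sym e) _)

≡ᵇ-false : ∀ {m n} → (m ≡ᵇ n) ≡ false → m ≢ n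
≡ᵇ-false {m} {n} e m≡n = ≡.subst T e (ℕₚ.≡⇒≡ᵇ m n m≡n)

is-last : ∀ {n} {j : Fin (suc n)} → (toℕ j ≡ᵇ n) ≡ true → j ≡ fromℕ n
is-last {n} e = Finₚ.toℕ-injective (≡.trans (≡ᵇ-true e) (≡.sym (Finₚ.toℕ-fromℕ n)))

unshift-+ : ∀ p₁ p₂ m a b → p₁ ℤ.+ p₂ ≡ m ℤ.+ + (a ℕ.+ b) → (p₁ ℤ.- + a) ℤ.+ (p₂ ℤ.- + b) ≡ m
unshift-+ p₁ p₂ m a b e = ≡.trans (regroup p₁ p₂ (+ a) (+ b))
  (≡.trans (cong (λ q → q ℤ.- (+ a ℤ.+ + b)) (≡.trans e (cong (λ q → m ℤ.+ q) (ℤₚ.pos-+ a b)))) (cancel m (+ a) (+ b)))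
  where
  regroup : ∀ p₁ p₂ a b → (p₁ ℤ.- a) ℤ.+ (p₂ ℤ.- b) ≡ p₁ ℤ.+ p₂ ℤ.- (a ℤ.+ b)
  regroup = solve-∀
  cancel : ∀ m a b → m ℤ.+ (a ℤ.+ b) ℤ.- (a ℤ.+ b) ≡ m
  cancel = solve-∀

suc[n∸k]∣[1+n]! : ∀ n k → suc (n ∸ k) ∣ suc n !
suc[n∸k]∣[1+n]! n k = ∣-trans (m∣m*n ((n ∸ k) !)) (m≤n⇒m!∣n! (s≤s (ℕₚ.m∸n≤m n k)))

neg-suc-*-pos : ∀ t R → -[1+ t ] ℤ.* + R ≡ ℤ.- + (suc t ℕ.* R)
neg-suc-*-pos t R =
  ≡.trans (≡.sym (ℤₚ.neg-distribˡ-* (+ suc t) (+ R))) (cong (λ z → ℤ.- z) (≡.sym (ℤₚ.pos-* (suc t) R)))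

module LaurentCoefficients {a ℓ} (K : CommutativeRing a ℓ) where
  open CommutativeRing K renaming (Carrier to C)
  open Over K
  open import Relation.Binary.Reasoning.Setoid setoid

  coeffₚ : PS → ℤ → C
  coeffₚ s (+ n)    = s n
  coeffₚ s -[1+ _ ] = 0#

  coeffₚ-cong : ∀ {s t} → s ≈ₚ t → ∀ p → coeffₚ s p ≈ coeffₚ t p
  coeffₚ-cong s≈t (+ n)    = s≈t n
  coeffₚ-cong s≈t -[1+ _ ] = refl

  coeffₚ-+ₚ : ∀ s t p → coeffₚ (s +ₚ t) p ≈ coeffₚ s p + coeffₚ t p
  coeffₚ-+ₚ s t (+ n)    = refl
  coeffₚ-+ₚ s t -[1+ _ ] = sym (+-identityʳ 0#)

  negCoeff≡coeffₚ : ∀ d s k → negCoeff d s k ≡ coeffₚ s (d ⊖ suc k)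
  negCoeff≡coeffₚ zero    s k       = ≡.refl
  negCoeff≡coeffₚ (suc d) s zero    = cong (coeffₚ s) (≡.sym (ℤₚ.[1+m]⊖[1+n]≡m⊖n d 0))
  negCoeff≡coeffₚ (suc d) s (suc k) =
    ≡.trans (negCoeff≡coeffₚ d s k) (cong (coeffₚ s) (≡.sym (ℤₚ.[1+m]⊖[1+n]≡m⊖n d (suc k))))

  coeff≡coeffₚ : ∀ x m → coeff x m ≡ coeffₚ (ser x) (m ℤ.+ + den x)
  coeff≡coeffₚ x (+ n)    = ≡.refl
  coeff≡coeffₚ x -[1+ k ] = negCoeff≡coeffₚ (den x) (ser x) k

  qPow≡coeffₚ : ∀ k s n → qPow k s n ≡ coeffₚ s (n ⊖ k)
  qPow≡coeffₚ zero    s n       = ≡.refl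
  qPow≡coeffₚ (suc k) s zero    = ≡.refl
  qPow≡coeffₚ (suc k) s (suc n) =
    ≡.trans (qPow≡coeffₚ k s n) (cong (coeffₚ s) (≡.sym (ℤₚ.[1+m]⊖[1+n]≡m⊖n n k)))

  coeffₚ-qPow : ∀ k s p → coeffₚ (qPow k s) p ≡ coeffₚ s (p ℤ.- + k)
  coeffₚ-qPow k       s (+ n)    = ≡.trans (qPow≡coeffₚ k s n) (cong (coeffₚ s) (≡.sym (ℤₚ.m-n≡m⊖n n k)))
  coeffₚ-qPow zero    s -[1+ _ ] = ≡.refl
  coeffₚ-qPow (suc k) s -[1+ _ ] = ≡.refl

  coeffₚ-shift : ∀ k s p → coeffₚ (qPow k s) (p ℤ.+ + k) ≡ coeffₚ s p
  coeffₚ-shift k s p = ≡.trans (coeffₚ-qPow k s (p ℤ.+ + k)) (cong (coeffₚ s) ([p+q]-q≡p p (+ k)))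
    where
    [p+q]-q≡p : ∀ p q → p ℤ.+ q ℤ.- q ≡ p
    [p+q]-q≡p = solve-∀

  coeff-shift : ∀ x k m → coeffₚ (qPow k (ser x)) (m ℤ.+ + (den x ℕ.+ k)) ≡ coeff x m
  coeff-shift x k m =
    ≡.trans (cong (coeffₚ (qPow k (ser x))) (shift-+ m (den x) k))
      (≡.trans (coeffₚ-shift k (ser x) (m ℤ.+ + den x)) (≡.sym (coeff≡coeffₚ x m)))
    where
    shift-+ : ∀ m a b → m ℤ.+ + (a ℕ.+ b) ≡ m ℤ.+ + a ℤ.+ + b
    shift-+ m a b = ≡.trans (cong (λ n → m ℤ.+ n) (ℤₚ.pos-+ a b)) (≡.sym (ℤₚ.+-assoc m (+ a) (+ b)))

  coeff-shift′ : ∀ x k m → coeffₚ (qPow k (ser x)) (m ℤ.+ + (k ℕ.+ den x)) ≡ coeff x m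
  coeff-shift′ x k m = ≡.trans (cong (λ n → coeffₚ (qPow k (ser x)) (m ℤ.+ + n)) (ℕₚ.+-comm k (den x))) (coeff-shift x k m)

  coeff-+ : ∀ x y m → coeff (x +ₗ y) m ≈ coeff x m + coeff y m
  coeff-+ x y m = begin
    coeff (x +ₗ y) m                                             ≡⟨ coeff≡coeffₚ (x +ₗ y) m ⟩
    coeffₚ (qPow (den y) (ser x) +ₚ qPow (den x) (ser y)) P     ≈⟨ coeffₚ-+ₚ _ _ P ⟩
    coeffₚ (qPow (den y) (ser x)) P + coeffₚ (qPow (den x) (ser y)) P
                                                         ≡⟨ ≡.cong₂ _+_ (coeff-shift x (den y) m) (coeff-shift′ y (den x) m) ⟩
    coeff x m + coeff y m                                        ∎
    where
    P : ℤ
    P = m ℤ.+ + (den x ℕ.+ den y)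

  coeff-cong : ∀ {x y} → x ≈ₗ y → ∀ m → coeff x m ≈ coeff y m
  coeff-cong {x} {y} x≈y m = begin
    coeff x m                                                 ≡⟨ coeff-shift x (den y) m ⟨
    coeffₚ (qPow (den y) (ser x)) (m ℤ.+ + (den x ℕ.+ den y)) ≈⟨ coeffₚ-cong x≈y (m ℤ.+ + (den x ℕ.+ den y)) ⟩
    coeffₚ (qPow (den x) (ser y)) (m ℤ.+ + (den x ℕ.+ den y)) ≡⟨ coeff-shift′ y (den x) m ⟩
    coeff y m                                                 ∎

  coeff-at-position : ∀ x p → coeff x (p ℤ.- + den x) ≡ coeffₚ (ser x) p
  coeff-at-position x p = ≡.trans (coeff≡coeffₚ x (p ℤ.- + den x)) (cong (coeffₚ (ser x)) ([p-q]+q≡p p (+ den x)))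
    where
    [p-q]+q≡p : ∀ p q → p ℤ.- q ℤ.+ q ≡ p
    [p-q]+q≡p = solve-∀

  coeffₚ-product : ∀ x y p₁ p₂
    → coeffₚ (ser x) p₁ * coeffₚ (ser y) p₂ ≡ coeff x (p₁ ℤ.- + den x) * coeff y (p₂ ℤ.- + den y)
  coeffₚ-product x y p₁ p₂ = ≡.sym (≡.cong₂ _*_ (coeff-at-position x p₁) (coeff-at-position y p₂))

  sumTo-zero : ∀ g N → (∀ i → i ≤ N → g i ≈ 0#) → sumTo g N ≈ 0#
  sumTo-zero g zero    g≈0 = g≈0 0 z≤n
  sumTo-zero g (suc N) g≈0 = begin
    sumTo g N + g (suc N) ≈⟨ +-cong (sumTo-zero g N (λ i i≤N → g≈0 i (ℕₚ.m≤n⇒m≤1+n i≤N)))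
                                    (g≈0 (suc N) ℕₚ.≤-refl) ⟩
    0# + 0#               ≈⟨ +-identityʳ 0# ⟩
    0#                    ∎

  sumTo-single : ∀ g N k → k ≤ N → (∀ i → i ≤ N → i ≢ k → g i ≈ 0#) → sumTo g N ≈ g k
  sumTo-single g zero    zero    _     _   = refl
  sumTo-single g (suc N) k       k≤1+N g≈0 with k ℕ.≟ suc N
  ... | yes ≡.refl = begin
    sumTo g N + g (suc N) ≈⟨ +-congʳ (sumTo-zero g N λ i i≤N →
                                        g≈0 i (ℕₚ.m≤n⇒m≤1+n i≤N) (ℕₚ.<⇒≢ (s≤s i≤N))) ⟩
    0# + g (suc N)        ≈⟨ +-identityˡ (g (suc N)) ⟩
    g (suc N)             ∎
  ... | no k≢1+N = begin
    sumTo g N + g (suc N) ≈⟨ +-cong (sumTo-single g N k k≤N (λ i i≤N → g≈0 i (ℕₚ.m≤n⇒m≤1+n i≤N)))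
                                    (g≈0 (suc N) ℕₚ.≤-refl (k≢1+N ∘ ≡.sym)) ⟩
    g k + 0#              ≈⟨ +-identityʳ (g k) ⟩
    g k                   ∎
    where
    k≤N : k ≤ N
    k≤N = ℕₚ.m<1+n⇒m≤n (ℕₚ.≤∧≢⇒< k≤1+N k≢1+N)

  coeffₚ-*-vanish : ∀ s t P → (∀ p₁ p₂ → p₁ ℤ.+ p₂ ≡ P → coeffₚ s p₁ * coeffₚ t p₂ ≈ 0#)
                  → coeffₚ (s *ₚ t) P ≈ 0#
  coeffₚ-*-vanish s t (+ N)    h = sumTo-zero _ N (λ i i≤N → h (+ i) (+ (N ∸ i)) (cong +_ (ℕₚ.m+[n∸m]≡n i≤N)))
  coeffₚ-*-vanish s t -[1+ _ ] h = refl

  coeffₚ-*-single-vanishing : ∀ s t P a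
    → (∀ p₁ p₂ → p₁ ℤ.+ p₂ ≡ P → p₁ ≢ a → coeffₚ s p₁ * coeffₚ t p₂ ≈ 0#)
    → coeffₚ s a * coeffₚ t (P ℤ.- a) ≈ 0# → coeffₚ (s *ₚ t) P ≈ coeffₚ s a * coeffₚ t (P ℤ.- a)
  coeffₚ-*-single-vanishing s t P a h term≈0 = trans (coeffₚ-*-vanish s t P term) (sym term≈0)
    where
    p₂≡P-p₁ : ∀ p₁ p₂ → p₁ ℤ.+ p₂ ≡ P → p₂ ≡ P ℤ.- p₁
    p₂≡P-p₁ p₁ p₂ ≡.refl = [p+q]-p≡q p₁ p₂
      where
      [p+q]-p≡q : ∀ p q → q ≡ p ℤ.+ q ℤ.- p
      [p+q]-p≡q = solve-∀
    term : ∀ p₁ p₂ → p₁ ℤ.+ p₂ ≡ P → coeffₚ s p₁ * coeffₚ t p₂ ≈ 0#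
    term p₁ p₂ e with p₁ ℤ.≟ a
    ... | yes ≡.refl = trans (reflexive (cong (λ p → coeffₚ s p₁ * coeffₚ t p) (p₂≡P-p₁ p₁ p₂ e))) term≈0
    ... | no p₁≢a    = h p₁ p₂ e p₁≢a

  coeffₚ-⊖-< : ∀ t {m n} → m < n → coeffₚ t (m ⊖ n) ≡ 0#
  coeffₚ-⊖-< t {zero}  {suc n} _         = ≡.refl
  coeffₚ-⊖-< t {suc m} {suc n} (s≤s m<n) = ≡.trans (cong (coeffₚ t) (ℤₚ.[1+m]⊖[1+n]≡m⊖n m n)) (coeffₚ-⊖-< t m<n)

  coeffₚ-negative-minus : ∀ t n i → coeffₚ t (-[1+ n ] ℤ.- + i) ≡ 0#
  coeffₚ-negative-minus t n zero    = ≡.refl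
  coeffₚ-negative-minus t n (suc i) = ≡.refl

  coeffₚ-*-single : ∀ s t P a → (∀ p₁ p₂ → p₁ ℤ.+ p₂ ≡ P → p₁ ≢ a → coeffₚ s p₁ * coeffₚ t p₂ ≈ 0#)
                  → coeffₚ (s *ₚ t) P ≈ coeffₚ s a * coeffₚ t (P ℤ.- a)
  coeffₚ-*-single s t (+ N) (+ i) h with i ℕ.≤? N
  ... | yes i≤N = begin
    sumTo (λ j → s j * t (N ∸ j)) N ≈⟨ sumTo-single _ N i i≤N other-terms ⟩
    s i * t (N ∸ i)                  ≡⟨ cong (λ p → s i * coeffₚ t p) (≡.trans (ℤₚ.m-n≡m⊖n N i) (ℤₚ.⊖-≥ i≤N)) ⟨
    s i * coeffₚ t (+ N ℤ.- + i)     ∎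
    where
    other-terms : ∀ j → j ≤ N → j ≢ i → s j * t (N ∸ j) ≈ 0#
    other-terms j j≤N j≢i = h (+ j) (+ (N ∸ j)) (cong +_ (ℕₚ.m+[n∸m]≡n j≤N)) (j≢i ∘ ℤₚ.+-injective)
  ... | no i≰N = coeffₚ-*-single-vanishing s t (+ N) (+ i) h
    (trans (*-congˡ (reflexive (≡.trans (cong (coeffₚ t) (ℤₚ.m-n≡m⊖n N i)) (coeffₚ-⊖-< t (ℕₚ.≰⇒> i≰N)))))
           (zeroʳ (s i)))
  coeffₚ-*-single s t (+ N) -[1+ j ] h = coeffₚ-*-single-vanishing s t (+ N) -[1+ j ] h (zeroˡ _)
  coeffₚ-*-single s t -[1+ n ] (+ i) h = coeffₚ-*-single-vanishing s t -[1+ n ] (+ i) h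
    (trans (*-congˡ (reflexive (coeffₚ-negative-minus t n i))) (zeroʳ (s i)))
  coeffₚ-*-single s t -[1+ n ] -[1+ j ] h = sym (zeroˡ _)

  coeff-*-vanish : ∀ x y m → (∀ m₁ m₂ → m₁ ℤ.+ m₂ ≡ m → coeff x m₁ * coeff y m₂ ≈ 0#) → coeff (x *ₗ y) m ≈ 0#
  coeff-*-vanish x y m h = trans (reflexive (coeff≡coeffₚ (x *ₗ y) m)) (coeffₚ-*-vanish (ser x) (ser y) _ term)
    where
    term : ∀ p₁ p₂ → p₁ ℤ.+ p₂ ≡ m ℤ.+ + (den x ℕ.+ den y) → coeffₚ (ser x) p₁ * coeffₚ (ser y) p₂ ≈ 0#
    term p₁ p₂ e = trans (reflexive (coeffₚ-product x y p₁ p₂))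
                         (h (p₁ ℤ.- + den x) (p₂ ℤ.- + den y) (unshift-+ p₁ p₂ m (den x) (den y) e))

  coeff-*-single : ∀ x y m a → (∀ m₁ m₂ → m₁ ℤ.+ m₂ ≡ m → m₁ ≢ a → coeff x m₁ * coeff y m₂ ≈ 0#)
                 → coeff (x *ₗ y) m ≈ coeff x a * coeff y (m ℤ.- a)
  coeff-*-single x y m a h = begin
    coeff (x *ₗ y) m                                   ≡⟨ coeff≡coeffₚ (x *ₗ y) m ⟩
    coeffₚ (ser x *ₚ ser y) P                          ≈⟨ coeffₚ-*-single (ser x) (ser y) P a′ term ⟩
    coeffₚ (ser x) a′ * coeffₚ (ser y) (P ℤ.- a′)      ≡⟨ ≡.cong₂ _*_ (coeff≡coeffₚ x a)
                                                            (≡.trans (coeff≡coeffₚ y (m ℤ.- a)) (cong (coeffₚ (ser y)) P-a′)) ⟨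
    coeff x a * coeff y (m ℤ.- a)                      ∎
    where
    P a′ : ℤ
    P  = m ℤ.+ + (den x ℕ.+ den y)
    a′ = a ℤ.+ + den x
    P-a′ : m ℤ.- a ℤ.+ + den y ≡ P ℤ.- a′
    P-a′ = ≡.trans (lemma m a (+ den x) (+ den y)) (cong (λ q → m ℤ.+ q ℤ.- a′) (≡.sym (ℤₚ.pos-+ (den x) (den y))))
      where
      lemma : ∀ m a b c → m ℤ.- a ℤ.+ c ≡ m ℤ.+ (b ℤ.+ c) ℤ.- (a ℤ.+ b)
      lemma = solve-∀
    term : ∀ p₁ p₂ → p₁ ℤ.+ p₂ ≡ P → p₁ ≢ a′ → coeffₚ (ser x) p₁ * coeffₚ (ser y) p₂ ≈ 0#
    term p₁ p₂ e p₁≢a′ = trans (reflexive (coeffₚ-product x y p₁ p₂))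
                               (h (p₁ ℤ.- + den x) (p₂ ℤ.- + den y) (unshift-+ p₁ p₂ m (den x) (den y) e) m₁≢a)
      where
      m₁≢a : p₁ ℤ.- + den x ≢ a
      m₁≢a ≡.refl = p₁≢a′ (lemma p₁ (+ den x))
        where
        lemma : ∀ p d → p ≡ p ℤ.- d ℤ.+ d
        lemma = solve-∀

  coeff-0ₗ : ∀ m → coeff 0ₗ m ≡ 0#
  coeff-0ₗ (+ _)    = ≡.refl
  coeff-0ₗ -[1+ _ ] = ≡.refl

  negCoeff-beyond : ∀ d s k → d ≤ k → negCoeff d s k ≡ 0#
  negCoeff-beyond zero    s k       _         = ≡.refl
  negCoeff-beyond (suc d) s (suc k) (s≤s d≤k) = negCoeff-beyond d s k d≤k

module CompanionAlgebra {a ℓ} (K : CommutativeRing a ℓ) where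
  open CommutativeRing K renaming (Carrier to C)
  open Over K
  open import Relation.Binary.Reasoning.Setoid setoid
  open import Algebra.Properties.CommutativeMonoid.Sum +-commutativeMonoid
    using (sum; sum-cong-≋; sum-replicate-zero; sum-remove; ∑-distrib-+)

  sum-zero : ∀ {n} (t : Fin n → C) → (∀ j → t j ≈ 0#) → sum t ≈ 0#
  sum-zero {n} t t≈0 = trans (sum-cong-≋ t≈0) (sum-replicate-zero n)

  sum-single : ∀ {n} (t : Fin (suc n) → C) k → (∀ j → j ≢ k → t j ≈ 0#) → sum t ≈ t k
  sum-single t k others≈0 = begin
    sum t                     ≈⟨ sum-remove {i = k} t ⟩
    t k + sum (removeAt t k)  ≈⟨ +-congˡ (sum-zero (removeAt t k) (λ j → others≈0 _ (Finₚ.punchInᵢ≢i k j))) ⟩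
    t k + 0#                  ≈⟨ +-identityʳ (t k) ⟩
    t k                       ∎

  matVecᴷ : ∀ {n} → (Fin n → Fin n → C) → (Fin n → C) → Fin n → C
  matVecᴷ M u i = sum (λ j → M i j * u j)

  matVecᴷ-cong : ∀ {n} (M : Fin n → Fin n → C) {u v} → (∀ j → u j ≈ v j) → ∀ i → matVecᴷ M u i ≈ matVecᴷ M v i
  matVecᴷ-cong M u≈v i = sum-cong-≋ (λ j → *-congˡ (u≈v j))

  companionᴷ : ∀ {n} → (Fin n → C) → Fin n → Fin n → C
  companionᴷ {n} c i j = if toℕ j ≡ᵇ (n ∸ 1) then c i else (if toℕ i ≡ᵇ suc (toℕ j) then 1# else 0#)

  shiftᴷ : ∀ {n} → (Fin (suc n) → C) → Fin (suc n) → C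
  shiftᴷ u fzero    = 0#
  shiftᴷ u (fsuc i) = u (inject₁ i)

  sum-subdiagonal : ∀ {n} (u : Fin (suc n) → C) i
    → sum (λ j → if toℕ j ≡ᵇ n then 0# else (if toℕ i ≡ᵇ suc (toℕ j) then u j else 0#)) ≈ shiftᴷ u i
  sum-subdiagonal {n} u fzero = sum-zero {suc n} _ term≈0
    where
    term≈0 : ∀ j → (if toℕ j ≡ᵇ n then 0# else 0#) ≈ 0#
    term≈0 j with toℕ j ≡ᵇ n
    ... | true  = refl
    ... | false = refl
  sum-subdiagonal {n} u (fsuc i) = trans (sum-single _ (inject₁ i) others≈0) on-diagonal
    where
    on-diagonal : (if toℕ (inject₁ i) ≡ᵇ n then 0# else (if toℕ i ≡ᵇ toℕ (inject₁ i) then u (inject₁ i) else 0#))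
                ≈ u (inject₁ i)
    on-diagonal with toℕ (inject₁ i) ≡ᵇ n in e₁ | toℕ i ≡ᵇ toℕ (inject₁ i) in e₂
    ... | true  | _     = contradiction (≡.sym (≡ᵇ-true e₁)) (Finₚ.toℕ-inject₁-≢ i)
    ... | false | true  = refl
    ... | false | false = contradiction (≡.sym (Finₚ.toℕ-inject₁ i)) (≡ᵇ-false e₂)
    others≈0 : ∀ j → j ≢ inject₁ i → (if toℕ j ≡ᵇ n then 0# else (if toℕ i ≡ᵇ toℕ j then u j else 0#)) ≈ 0#
    others≈0 j j≢i with toℕ j ≡ᵇ n | toℕ i ≡ᵇ toℕ j in e
    ... | true  | _     = refl
    ... | false | true  = contradiction (Finₚ.toℕ-injective (≡.trans (≡.sym (≡ᵇ-true e)) (≡.sym (Finₚ.toℕ-inject₁ i)))) j≢i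
    ... | false | false = refl

  companionᴷ-row : ∀ {n} (c u : Fin (suc n) → C) i → matVecᴷ (companionᴷ c) u i ≈ shiftᴷ u i + c i * u (fromℕ n)
  companionᴷ-row {n} c u i = begin
    sum (λ j → companionᴷ c i j * u j)  ≈⟨ sum-cong-≋ split ⟩
    sum (λ j → X j + Y j)               ≈⟨ ∑-distrib-+ X Y ⟩
    sum X + sum Y                       ≈⟨ +-comm (sum X) (sum Y) ⟩
    sum Y + sum X                       ≈⟨ +-cong (sum-subdiagonal u i) (sum-single X (fromℕ n) X-others) ⟩
    shiftᴷ u i + X (fromℕ n)            ≡⟨ cong (λ b → shiftᴷ u i + (if b then c i * u (fromℕ n) else 0#)) last≡ᵇn ⟩
    shiftᴷ u i + c i * u (fromℕ n)      ∎
    where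
    X Y : Fin (suc n) → C
    X j = if toℕ j ≡ᵇ n then c i * u j else 0#
    Y j = if toℕ j ≡ᵇ n then 0# else (if toℕ i ≡ᵇ suc (toℕ j) then u j else 0#)
    split : ∀ j → companionᴷ c i j * u j ≈ X j + Y j
    split j with toℕ j ≡ᵇ n | toℕ i ≡ᵇ suc (toℕ j)
    ... | true  | _     = sym (+-identityʳ _)
    ... | false | true  = trans (*-identityˡ (u j)) (sym (+-identityˡ (u j)))
    ... | false | false = trans (zeroˡ (u j)) (sym (+-identityˡ 0#))
    last≡ᵇn : (toℕ (fromℕ n) ≡ᵇ n) ≡ true
    last≡ᵇn = ≡.subst (λ m → (m ≡ᵇ n) ≡ true) (≡.sym (Finₚ.toℕ-fromℕ n)) (≡ᵇ-refl n)
    X-others : ∀ j → j ≢ fromℕ n → X j ≈ 0#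
    X-others j j≢last with toℕ j ≡ᵇ n in e
    ... | true  = contradiction (is-last e) j≢last
    ... | false = refl

  Vanishes : ∀ {n} → (Fin n → C) → Set ℓ
  Vanishes u = ∀ i → u i ≈ 0#

  VanishesBelow : ∀ {n} → ℕ → (Fin n → C) → Set ℓ
  VanishesBelow k u = ∀ j → toℕ j < k → u j ≈ 0#

  basisᴷ : ∀ {n} → ℕ → Fin n → C
  basisᴷ k j = if toℕ j ≡ᵇ k then 1# else 0#

  basisᴷ-off : ∀ {n k} (j : Fin n) → toℕ j ≢ k → basisᴷ k j ≈ 0#
  basisᴷ-off {k = k} j j≢k with toℕ j ≡ᵇ k in e
  ... | true  = contradiction (≡ᵇ-true e) j≢k
  ... | false = refl

  basisᴷ-nonzero : IsField → ∀ {n k} → k < n → ¬ Vanishes {n} (basisᴷ k)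
  basisᴷ-nonzero (1≉0 , _) {k = k} k<n vanishes =
    1≉0 (≡.subst (λ b → (if b then 1# else 0#) ≈ 0#) on-k (vanishes (fromℕ< k<n)))
    where
    on-k : (toℕ (fromℕ< k<n) ≡ᵇ k) ≡ true
    on-k = ≡.subst (λ m → (m ≡ᵇ k) ≡ true) (≡.sym (Finₚ.toℕ-fromℕ< k<n)) (≡ᵇ-refl k)

  shiftᴷ-vanishesBelow : ∀ {n k} {u : Fin (suc n) → C} → VanishesBelow k u → VanishesBelow (suc k) (shiftᴷ u)
  shiftᴷ-vanishesBelow u-below fzero    _         = refl
  shiftᴷ-vanishesBelow u-below (fsuc j) (s≤s j<k) = u-below (inject₁ j) (≡.subst (_< _) (≡.sym (Finₚ.toℕ-inject₁ j)) j<k)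

  companionᴷ-basis : ∀ {n} (c : Fin (suc n) → C) {k} → k < n → ∀ j
                   → matVecᴷ (companionᴷ c) (basisᴷ k) j ≈ basisᴷ (suc k) j
  companionᴷ-basis {n} c {k} k<n j = begin
    matVecᴷ (companionᴷ c) (basisᴷ k) j             ≈⟨ companionᴷ-row c (basisᴷ k) j ⟩
    shiftᴷ (basisᴷ k) j + c j * basisᴷ k (fromℕ n)  ≈⟨ +-congˡ (trans (*-congˡ last≈0) (zeroʳ (c j))) ⟩
    shiftᴷ (basisᴷ k) j + 0#                        ≈⟨ +-identityʳ _ ⟩
    shiftᴷ (basisᴷ k) j                             ≈⟨ shift-basis j ⟩
    basisᴷ (suc k) j                                ∎
    where
    last≈0 : basisᴷ k (fromℕ n) ≈ 0#
    last≈0 = basisᴷ-off (fromℕ n) (≡.subst (_≢ k) (≡.sym (Finₚ.toℕ-fromℕ n)) (ℕₚ.>⇒≢ k<n))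
    shift-basis : ∀ j → shiftᴷ (basisᴷ k) j ≈ basisᴷ (suc k) j
    shift-basis fzero    = refl
    shift-basis (fsuc j) = reflexive (cong (λ m → if m ≡ᵇ k then 1# else 0#) (Finₚ.toℕ-inject₁ j))

  field-cancel : IsField → ∀ {x y} → ¬ x ≈ 0# → x * y ≈ 0# → y ≈ 0#
  field-cancel (_ , inverse) {x} {y} x≉0 xy≈0 with inverse x x≉0
  ... | x⁻¹ , xx⁻¹≈1 = begin
    y              ≈⟨ *-identityˡ y ⟨
    1# * y         ≈⟨ *-congʳ xx⁻¹≈1 ⟨
    x * x⁻¹ * y    ≈⟨ *-congʳ (*-comm x x⁻¹) ⟩
    x⁻¹ * x * y    ≈⟨ *-assoc x⁻¹ x y ⟩
    x⁻¹ * (x * y)  ≈⟨ *-congˡ xy≈0 ⟩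
    x⁻¹ * 0#       ≈⟨ zeroʳ x⁻¹ ⟩
    0#             ∎

  companionᴷ-vanishesBelow : ∀ {n k} (c : Fin (suc n) → C) {u} → VanishesBelow k c → VanishesBelow k u
                           → VanishesBelow k (matVecᴷ (companionᴷ c) u)
  companionᴷ-vanishesBelow {n} c {u} c-below u-below j j<k = begin
    matVecᴷ (companionᴷ c) u j      ≈⟨ companionᴷ-row c u j ⟩
    shiftᴷ u j + c j * u (fromℕ n)  ≈⟨ +-cong (shiftᴷ-vanishesBelow u-below j (ℕₚ.m<n⇒m<1+n j<k))
                                              (trans (*-congʳ (c-below j j<k)) (zeroˡ _)) ⟩
    0# + 0#                         ≈⟨ +-identityʳ 0# ⟩
    0#                              ∎

  -- On vectors vanishing below the first nonzero entry c i₀, row i₀ recovers the last entry and the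
  -- subdiagonal the others.
  companionᴷ-injectiveBelow : IsField → ∀ {n} (c : Fin (suc n) → C) i₀ → ¬ c i₀ ≈ 0#
    → ∀ {u} → VanishesBelow (toℕ i₀) u → Vanishes (matVecᴷ (companionᴷ c) u) → Vanishes u
  companionᴷ-injectiveBelow isField {n} c i₀ c-i₀≉0 {u} u-below Lu≈0 j = on j (last-or-inject₁ j)
    where
    u-last≈0 : u (fromℕ n) ≈ 0#
    u-last≈0 = field-cancel isField c-i₀≉0 (begin
      c i₀ * u (fromℕ n)                ≈⟨ +-identityˡ _ ⟨
      0# + c i₀ * u (fromℕ n)           ≈⟨ +-congʳ (shiftᴷ-vanishesBelow u-below i₀ (ℕₚ.n<1+n (toℕ i₀))) ⟨
      shiftᴷ u i₀ + c i₀ * u (fromℕ n)  ≈⟨ companionᴷ-row c u i₀ ⟨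
      matVecᴷ (companionᴷ c) u i₀       ≈⟨ Lu≈0 i₀ ⟩
      0#                                ∎)
    on : ∀ j → j ≡ fromℕ n ⊎ ∃ (λ j′ → j ≡ inject₁ j′) → u j ≈ 0#
    on _ (inj₁ ≡.refl)        = u-last≈0
    on _ (inj₂ (j′ , ≡.refl)) = begin
      u (inject₁ j′)                                  ≈⟨ +-identityʳ _ ⟨
      u (inject₁ j′) + 0#                             ≈⟨ +-congˡ (trans (*-congˡ u-last≈0) (zeroʳ _)) ⟨
      shiftᴷ u (fsuc j′) + c (fsuc j′) * u (fromℕ n)  ≈⟨ companionᴷ-row c u (fsuc j′) ⟨
      matVecᴷ (companionᴷ c) u (fsuc j′)              ≈⟨ Lu≈0 (fsuc j′) ⟩
      0#                                              ∎

  iterate-+ : ∀ {a} {A : Set a} (f : A → A) t m x → iterate f (t ℕ.+ m) x ≡ iterate f t (iterate f m x)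
  iterate-+ f zero    m x = ≡.refl
  iterate-+ f (suc t) m x = cong f (iterate-+ f t m x)

  companionᴷ-iterate-basis : ∀ {n} (c : Fin (suc n) → C) k → k ≤ n → ∀ j
                           → iterate (matVecᴷ (companionᴷ c)) k (basisᴷ 0) j ≈ basisᴷ k j
  companionᴷ-iterate-basis c zero    _   j = refl
  companionᴷ-iterate-basis c (suc k) k<n j =
    trans (matVecᴷ-cong (companionᴷ c) (companionᴷ-iterate-basis c k (ℕₚ.<⇒≤ k<n)) j) (companionᴷ-basis c k<n j)

  ¬¬-first-nonzero : ∀ {n} (u : Fin n → C) → ¬ Vanishes u → ¬ ¬ (∃ λ i₀ → ¬ u i₀ ≈ 0# × VanishesBelow (toℕ i₀) u)
  ¬¬-first-nonzero u u≉0 k =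
    ¬¬-Π-Fin (λ _ → ¬¬-excluded-middle) λ u≈0? → from-smallest (Finₚ.¬∀⟶∃¬-smallest _ _ u≈0? u≉0)
    where
    from-smallest : ∃ (λ i₀ → ¬ u i₀ ≈ 0# × ((j : Fin.Fin′ i₀) → u (Fin.inject j) ≈ 0#)) → ⊥
    from-smallest (i₀ , u-i₀≉0 , u-before) = k (i₀ , u-i₀≉0 , u-below)
      where
      u-below : VanishesBelow (toℕ i₀) u
      u-below j j<i₀ = ≡.subst (λ j → u j ≈ 0#) inject≡j (u-before (fromℕ< j<i₀))
        where
        inject≡j : Fin.inject (fromℕ< j<i₀) ≡ j
        inject≡j = Finₚ.toℕ-injective (≡.trans (Finₚ.toℕ-inject _) (Finₚ.toℕ-fromℕ< j<i₀))

  companionᴷ-iterate-nonzeroBelow : IsField → ∀ {n} (c : Fin (suc n) → C) i₀ → ¬ c i₀ ≈ 0# → VanishesBelow (toℕ i₀) c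
    → ∀ t {v} → VanishesBelow (toℕ i₀) v → ¬ Vanishes v
    → VanishesBelow (toℕ i₀) (iterate (matVecᴷ (companionᴷ c)) t v) × ¬ Vanishes (iterate (matVecᴷ (companionᴷ c)) t v)
  companionᴷ-iterate-nonzeroBelow isField c i₀ c-i₀≉0 c-below zero    v-below v≉0 = v-below , v≉0
  companionᴷ-iterate-nonzeroBelow isField c i₀ c-i₀≉0 c-below (suc t) v-below v≉0
    with companionᴷ-iterate-nonzeroBelow isField c i₀ c-i₀≉0 c-below t v-below v≉0
  ... | w-below , w≉0 =
    companionᴷ-vanishesBelow c c-below w-below , w≉0 ∘ companionᴷ-injectiveBelow isField c i₀ c-i₀≉0 w-below

  companionᴷ-not-nilpotent : IsField → ∀ {n} (c : Fin (suc n) → C) → ¬ Vanishes c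
                           → ∀ k → ¬ Vanishes (iterate (matVecᴷ (companionᴷ c)) k (basisᴷ 0))
  companionᴷ-not-nilpotent isField {n} c c≉0 k Lᵏe₀≈0 = ¬¬-first-nonzero c c≉0 from-first-nonzero
    where
    L : (Fin (suc n) → C) → Fin (suc n) → C
    L = matVecᴷ (companionᴷ c)
    early-iterate≉0 : ∀ {m} → m ≤ n → ¬ Vanishes (iterate L m (basisᴷ 0))
    early-iterate≉0 {m} m≤n v≈0 =
      basisᴷ-nonzero isField (s≤s m≤n) λ j → trans (sym (companionᴷ-iterate-basis c m m≤n j)) (v≈0 j)
    from-first-nonzero : ∃ (λ i₀ → ¬ c i₀ ≈ 0# × VanishesBelow (toℕ i₀) c) → ⊥
    from-first-nonzero (i₀ , c-i₀≉0 , c-below) with k ℕ.≤? toℕ i₀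
    ... | yes k≤i₀ = early-iterate≉0 (ℕₚ.≤-trans k≤i₀ (Finₚ.toℕ≤pred[n] i₀)) Lᵏe₀≈0
    ... | no k≰i₀  =
      proj₂ (companionᴷ-iterate-nonzeroBelow isField c i₀ c-i₀≉0 c-below (k ∸ toℕ i₀) e-below (early-iterate≉0 i₀≤n))
            (≡.subst Vanishes k-split Lᵏe₀≈0)
      where
      i₀≤n : toℕ i₀ ≤ n
      i₀≤n = Finₚ.toℕ≤pred[n] i₀
      e-below : VanishesBelow (toℕ i₀) (iterate L (toℕ i₀) (basisᴷ 0))
      e-below j j<i₀ = trans (companionᴷ-iterate-basis c (toℕ i₀) i₀≤n j) (basisᴷ-off j (ℕₚ.<⇒≢ j<i₀))
      k-split : iterate L k (basisᴷ 0) ≡ iterate L (k ∸ toℕ i₀) (iterate L (toℕ i₀) (basisᴷ 0))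
      k-split = ≡.trans (cong (λ m → iterate L m (basisᴷ 0)) (≡.sym (ℕₚ.m∸n+n≡m (ℕₚ.<⇒≤ (ℕₚ.≰⇒> k≰i₀)))))
                        (iterate-+ L (k ∸ toℕ i₀) (toℕ i₀) (basisᴷ 0))

module WeightedOrder {a ℓ} (K : CommutativeRing a ℓ) (R : ℕ) .{{R≢0 : NonZero R}} where
  open CommutativeRing K renaming (Carrier to C)
  open Over K
  open LaurentCoefficients K
  open CompanionAlgebra K
  open import Relation.Binary.Reasoning.Setoid setoid
  open import Algebra.Properties.CommutativeMonoid.Sum +-commutativeMonoid using (sum)

  -- R · v_q(x) ≥ T, i.e. valuations are measured in units of 1/R.
  OrderAtLeast : ℤ → Laurent → Set ℓ
  OrderAtLeast T x = ∀ m → m ℤ.* + R ℤ.< T → coeff x m ≈ 0#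

  -- α is the coefficient of q^(T/R) in x, where that coefficient is 0 when T/R is not an integer.
  LeadingCoeff : ℤ → Laurent → C → Set ℓ
  LeadingCoeff T x α = (∀ m → T ≡ m ℤ.* + R → coeff x m ≈ α) × (¬ (+ R ∣ℤ T) → α ≈ 0#)

  *R-distrib : ∀ m₁ m₂ {m} → m₁ ℤ.+ m₂ ≡ m → m₁ ℤ.* + R ℤ.+ m₂ ℤ.* + R ≡ m ℤ.* + R
  *R-distrib m₁ m₂ e = ≡.trans (≡.sym (ℤₚ.*-distribʳ-+ (+ R) m₁ m₂)) (cong (ℤ._* + R) e)

  order-mono : ∀ {T′ T x} → T′ ℤ.≤ T → OrderAtLeast T x → OrderAtLeast T′ x
  order-mono T′≤T x≥T m mR<T′ = x≥T m (ℤₚ.<-≤-trans mR<T′ T′≤T)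

  order-0ₗ : ∀ T → OrderAtLeast T 0ₗ
  order-0ₗ T m _ = reflexive (coeff-0ₗ m)

  order-1ₗ : OrderAtLeast 0ℤ 1ₗ
  order-1ₗ (+ n)    nR<0 = contradiction (≡.subst (ℤ._< 0ℤ) (≡.sym (ℤₚ.pos-* n R)) nR<0) λ { (ℤ.+<+ ()) }
  order-1ₗ -[1+ _ ] _    = refl

  order-+ : ∀ {T x y} → OrderAtLeast T x → OrderAtLeast T y → OrderAtLeast T (x +ₗ y)
  order-+ {x = x} {y} x≥T y≥T m mR<T = begin
    coeff (x +ₗ y) m      ≈⟨ coeff-+ x y m ⟩
    coeff x m + coeff y m ≈⟨ +-cong (x≥T m mR<T) (y≥T m mR<T) ⟩
    0# + 0#               ≈⟨ +-identityʳ 0# ⟩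
    0#                    ∎

  product-vanishes : ∀ {T₁ T₂ x y} m₁ m₂ → OrderAtLeast T₁ x → OrderAtLeast T₂ y
                   → m₁ ℤ.* + R ℤ.< T₁ ⊎ m₂ ℤ.* + R ℤ.< T₂ → coeff x m₁ * coeff y m₂ ≈ 0#
  product-vanishes {x = x} {y} m₁ m₂ x≥T₁ _ (inj₁ m₁R<T₁) = trans (*-congʳ (x≥T₁ m₁ m₁R<T₁)) (zeroˡ (coeff y m₂))
  product-vanishes {x = x} {y} m₁ m₂ _ y≥T₂ (inj₂ m₂R<T₂) = trans (*-congˡ (y≥T₂ m₂ m₂R<T₂)) (zeroʳ (coeff x m₁))

  order-* : ∀ {T₁ T₂ x y} → OrderAtLeast T₁ x → OrderAtLeast T₂ y → OrderAtLeast (T₁ ℤ.+ T₂) (x *ₗ y)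
  order-* {x = x} {y} x≥T₁ y≥T₂ m mR<T = coeff-*-vanish x y m λ m₁ m₂ e →
    product-vanishes m₁ m₂ x≥T₁ y≥T₂ (+-<-split (≡.subst (ℤ._< _) (≡.sym (*R-distrib m₁ m₂ e)) mR<T))

  *R-injective : ∀ {m m′} → m ℤ.* + R ≡ m′ ℤ.* + R → m ≡ m′
  *R-injective {m} {m′} = ℤₚ.*-cancelʳ-≡ m m′ (+ R)

  leading-0ₗ : ∀ T → LeadingCoeff T 0ₗ 0#
  leading-0ₗ T = (λ m _ → reflexive (coeff-0ₗ m)) , λ _ → refl

  leading-1ₗ : LeadingCoeff 0ℤ 1ₗ 1#
  leading-1ₗ = on-position , λ R∤0 → contradiction (divides 0ℤ ≡.refl) R∤0
    where
    on-position : ∀ m → 0ℤ ≡ m ℤ.* + R → coeff 1ₗ m ≈ 1#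
    on-position m 0≡mR with *R-injective {m} {0ℤ} (≡.sym 0≡mR)
    ... | ≡.refl = refl

  leading-resp : ∀ {T x α β} → α ≈ β → LeadingCoeff T x α → LeadingCoeff T x β
  leading-resp α≈β (on-position , off-position) =
    (λ m e → trans (on-position m e) α≈β) , λ R∤T → trans (sym α≈β) (off-position R∤T)

  leading-cong : ∀ {T x y α} → x ≈ₗ y → LeadingCoeff T x α → LeadingCoeff T y α
  leading-cong x≈y (on-position , off-position) = (λ m e → trans (sym (coeff-cong x≈y m)) (on-position m e)) , off-position

  leading-unique : ∀ {T x α β} → LeadingCoeff T x α → LeadingCoeff T x β → α ≈ β
  leading-unique {T} (on-α , off-α) (on-β , off-β) with + R ∣? T
  ... | yes (divides m T≡mR) = trans (sym (on-α m T≡mR)) (on-β m T≡mR)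
  ... | no R∤T               = trans (off-α R∤T) (sym (off-β R∤T))

  leading-exists : ∀ T x → ∃ (LeadingCoeff T x)
  leading-exists T x with + R ∣? T
  ... | yes (divides m T≡mR) = coeff x m , on-position , λ R∤T → contradiction (divides m T≡mR) R∤T
    where
    on-position : ∀ m′ → T ≡ m′ ℤ.* + R → coeff x m′ ≈ coeff x m
    on-position m′ T≡m′R with *R-injective {m′} {m} (≡.trans (≡.sym T≡m′R) T≡mR)
    ... | ≡.refl = refl
  ... | no R∤T = 0# , (λ m T≡mR → contradiction (divides m T≡mR) R∤T) , λ _ → refl

  order⇒leading-0 : ∀ {T′ T x} → T′ ℤ.< T → OrderAtLeast T x → LeadingCoeff T′ x 0#
  order⇒leading-0 T′<T x≥T = (λ m T′≡mR → x≥T m (≡.subst (ℤ._< _) T′≡mR T′<T)) , λ _ → refl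

  leading-+ : ∀ {T x y α β} → LeadingCoeff T x α → LeadingCoeff T y β → LeadingCoeff T (x +ₗ y) (α + β)
  leading-+ {x = x} {y} (on-α , off-α) (on-β , off-β) =
    (λ m e → trans (coeff-+ x y m) (+-cong (on-α m e) (on-β m e))) ,
    λ R∤T → trans (+-cong (off-α R∤T) (off-β R∤T)) (+-identityʳ 0#)

  off-leading-term-vanishes : ∀ {T₁ T₂ x y m} m₁ m₂ → OrderAtLeast T₁ x → OrderAtLeast T₂ y
    → T₁ ℤ.+ T₂ ≡ m ℤ.* + R → m₁ ℤ.+ m₂ ≡ m → m₁ ℤ.* + R ≢ T₁ → coeff x m₁ * coeff y m₂ ≈ 0#
  off-leading-term-vanishes m₁ m₂ x≥T₁ y≥T₂ T≡mR e m₁R≢T₁ = product-vanishes m₁ m₂ x≥T₁ y≥T₂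
    (+-≡-split (≡.trans (*R-distrib m₁ m₂ e) (≡.sym T≡mR)) m₁R≢T₁)

  leading-* : ∀ {T₁ T₂ x y α β} → OrderAtLeast T₁ x → OrderAtLeast T₂ y
            → LeadingCoeff T₁ x α → LeadingCoeff T₂ y β → LeadingCoeff (T₁ ℤ.+ T₂) (x *ₗ y) (α * β)
  leading-* {T₁} {T₂} {x} {y} {α} {β} x≥T₁ y≥T₂ (on-α , off-α) (on-β , off-β) = on-position , off-position
    where
    on-position : ∀ m → T₁ ℤ.+ T₂ ≡ m ℤ.* + R → coeff (x *ₗ y) m ≈ α * β
    on-position m T≡mR with + R ∣? T₁
    ... | yes (divides a T₁≡aR) = begin
      coeff (x *ₗ y) m              ≈⟨ coeff-*-single x y m a (λ m₁ m₂ e m₁≢a →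
                                         off-leading-term-vanishes m₁ m₂ x≥T₁ y≥T₂ T≡mR e
                                           (m₁≢a ∘ λ m₁R≡T₁ → *R-injective (≡.trans m₁R≡T₁ T₁≡aR))) ⟩
      coeff x a * coeff y (m ℤ.- a) ≈⟨ *-cong (on-α a T₁≡aR) (on-β (m ℤ.- a) T₂≡[m-a]R) ⟩
      α * β                         ∎
      where
      T₂≡[m-a]R : T₂ ≡ (m ℤ.- a) ℤ.* + R
      T₂≡[m-a]R = ≡.trans (lemma T₁ T₂) (≡.trans (≡.cong₂ ℤ._-_ T≡mR T₁≡aR) (lemma′ m a (+ R)))
        where
        lemma : ∀ T₁ T₂ → T₂ ≡ T₁ ℤ.+ T₂ ℤ.- T₁
        lemma = solve-∀
        lemma′ : ∀ m a r → m ℤ.* r ℤ.- a ℤ.* r ≡ (m ℤ.- a) ℤ.* r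
        lemma′ = solve-∀
    ... | no R∤T₁ = begin
      coeff (x *ₗ y) m ≈⟨ coeff-*-vanish x y m (λ m₁ m₂ e → off-leading-term-vanishes m₁ m₂ x≥T₁ y≥T₂ T≡mR e
                            λ m₁R≡T₁ → R∤T₁ (divides m₁ (≡.sym m₁R≡T₁))) ⟩
      0#               ≈⟨ zeroˡ β ⟨
      0# * β           ≈⟨ *-congʳ (off-α R∤T₁) ⟨
      α * β            ∎
    off-position : ¬ (+ R ∣ℤ (T₁ ℤ.+ T₂)) → α * β ≈ 0#
    off-position R∤T with + R ∣? T₁ | + R ∣? T₂
    ... | no R∤T₁               | _                     = trans (*-congʳ (off-α R∤T₁)) (zeroˡ β)
    ... | yes _                 | no R∤T₂               = trans (*-congˡ (off-β R∤T₂)) (zeroʳ α)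
    ... | yes (divides a T₁≡aR) | yes (divides b T₂≡bR) =
      contradiction (divides (a ℤ.+ b) (≡.trans (≡.cong₂ ℤ._+_ T₁≡aR T₂≡bR) (≡.sym (ℤₚ.*-distribʳ-+ (+ R) a b)))) R∤T

  order-sumFin : ∀ {n T} (h : Fin n → Laurent) → (∀ j → OrderAtLeast T (h j)) → OrderAtLeast T (sumFin h)
  order-sumFin {zero}  h h≥T = order-0ₗ _
  order-sumFin {suc n} h h≥T = order-+ (h≥T fzero) (order-sumFin (h ∘ fsuc) (h≥T ∘ fsuc))

  leading-sumFin : ∀ {n T} (h : Fin n → Laurent) (α : Fin n → C) → (∀ j → LeadingCoeff T (h j) (α j))
                 → LeadingCoeff T (sumFin h) (sum α)
  leading-sumFin {zero}  h α hα = leading-0ₗ _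
  leading-sumFin {suc n} h α hα = leading-+ (hα fzero) (leading-sumFin (h ∘ fsuc) (α ∘ fsuc) (hα ∘ fsuc))

  PreservesOrder : (Laurent → Laurent) → Set (a ⊔ ℓ)
  PreservesOrder E = ∀ T x → OrderAtLeast T x → OrderAtLeast T (E x)

  iterate-preservesOrder : ∀ {E} → PreservesOrder E → ∀ n → PreservesOrder (iterate E n)
  iterate-preservesOrder E-ord zero    T x x≥T = x≥T
  iterate-preservesOrder E-ord (suc n) T x x≥T = E-ord T _ (iterate-preservesOrder E-ord n T x x≥T)

  extend-preservesOrder : ∀ {D} → QIntegral D → PreservesOrder (extend D)
  extend-preservesOrder {D} D-integral T x x≥T m mR<T
    rewrite coeff≡coeffₚ (extend D x) m with m ℤ.+ + den x in m+d≡n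
  ... | + n      = D-integral (ser x) (suc n) low-coeffs n ℕₚ.≤-refl
    where
    low-coeffs : ∀ i → i < suc n → ser x i ≈ 0#
    low-coeffs i i<1+n = begin
      ser x i                    ≡⟨ coeff-at-position x (+ i) ⟨
      coeff x (+ i ℤ.- + den x)  ≈⟨ x≥T (+ i ℤ.- + den x) (ℤₚ.≤-<-trans (ℤₚ.*-monoʳ-≤-nonNeg (+ R) i-d≤m) mR<T) ⟩
      0#                         ∎
      where
      i-d≤m : + i ℤ.- + den x ℤ.≤ m
      i-d≤m = ≡.subst (+ i ℤ.- + den x ℤ.≤_) (≡.trans (cong (ℤ._- + den x) (≡.sym m+d≡n)) ([m+d]-d≡m m (+ den x)))
                (ℤₚ.+-monoˡ-≤ (ℤ.- + den x) (ℤ.+≤+ (ℕₚ.m<1+n⇒m≤n i<1+n)))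
        where
        [m+d]-d≡m : ∀ m d → m ℤ.+ d ℤ.- d ≡ m
        [m+d]-d≡m = solve-∀
  ... | -[1+ _ ] = refl

  -- Coordinate i carries weight i·S: after k steps, coordinate i has order at least (i - k)·S/R.
  module Graded (S : ℕ) .{{S≢0 : NonZero S}} (r′ : ℕ) where

    r : ℕ
    r = suc r′

    last : Fin r
    last = fromℕ r′

    weight : Fin r → ℤ
    weight i = + (toℕ i ℕ.* S)

    level : ℕ → Fin r → ℤ
    level k i = weight i ℤ.- + (k ℕ.* S)

    entryLevel : Fin r → Fin r → ℤ
    entryLevel i j = weight i ℤ.- weight j ℤ.- + S

    entryLevel-step : ∀ k i j → entryLevel i j ℤ.+ level k j ≡ level (suc k) i
    entryLevel-step k i j = ≡.trans (lemma (weight i) (weight j) (+ S) (+ (k ℕ.* S)))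
                                    (cong (λ z → weight i ℤ.- z) (≡.sym (ℤₚ.pos-+ S (k ℕ.* S))))
      where
      lemma : ∀ a b s t → a ℤ.- b ℤ.- s ℤ.+ (b ℤ.- t) ≡ a ℤ.- (s ℤ.+ t)
      lemma = solve-∀

    level-< : ∀ {k l} → k < l → ∀ i → level l i ℤ.< level k i
    level-< k<l i = ℤₚ.+-monoʳ-< (weight i) (ℤₚ.neg-mono-< (ℤ.+<+ (ℕₚ.*-monoˡ-< S k<l)))

    entryLevel-subdiagonal : ∀ {i j} → toℕ i ≡ suc (toℕ j) → entryLevel i j ≡ 0ℤ
    entryLevel-subdiagonal {i} {j} i≡1+j = ≡.trans (cong (λ n → + (n ℕ.* S) ℤ.- weight j ℤ.- + S) i≡1+j)
      (≡.trans (cong (λ z → z ℤ.- weight j ℤ.- + S) (ℤₚ.pos-+ S (toℕ j ℕ.* S))) (lemma (+ S) (weight j)))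
      where
      lemma : ∀ s w → s ℤ.+ w ℤ.- w ℤ.- s ≡ 0ℤ
      lemma = solve-∀

    entryLevel-last : ∀ i → entryLevel i last ≡ ℤ.- + (suc (r′ ∸ toℕ i) ℕ.* S)
    entryLevel-last i =
      ≡.trans (cong (λ n → weight i ℤ.- + n ℤ.- + S) r′S≡g+iS)
        (≡.trans (cong (λ z → weight i ℤ.- z ℤ.- + S) (ℤₚ.pos-+ g (toℕ i ℕ.* S)))
          (≡.trans (lemma (weight i) (+ g) (+ S)) (cong (λ z → ℤ.- z) (≡.sym (ℤₚ.pos-+ S g)))))
      where
      g : ℕ
      g = (r′ ∸ toℕ i) ℕ.* S
      r′S≡g+iS : toℕ last ℕ.* S ≡ g ℕ.+ toℕ i ℕ.* S
      r′S≡g+iS = ≡.trans (cong (ℕ._* S) (≡.trans (Finₚ.toℕ-fromℕ r′)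
                                                  (≡.sym (ℕₚ.m∸n+n≡m (Finₚ.toℕ≤pred[n] i)))))
                         (ℕₚ.*-distribʳ-+ S (r′ ∸ toℕ i) (toℕ i))
      lemma : ∀ a g s → a ℤ.- (g ℤ.+ a) ℤ.- s ≡ ℤ.- (s ℤ.+ g)
      lemma = solve-∀

    OrderAtLeastᵛ : ℕ → LVec r → Set ℓ
    OrderAtLeastᵛ k w = ∀ i → OrderAtLeast (level k i) (w i)

    LeadingCoeffᵛ : ℕ → LVec r → (Fin r → C) → Set ℓ
    LeadingCoeffᵛ k w u = ∀ i → LeadingCoeff (level k i) (w i) (u i)

    OrderAtLeastᴹ : LMat r → Set ℓ
    OrderAtLeastᴹ A = ∀ i j → OrderAtLeast (entryLevel i j) (A i j)

    LeadingCoeffᴹ : LMat r → (Fin r → Fin r → C) → Set ℓ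
    LeadingCoeffᴹ A L = ∀ i j → LeadingCoeff (entryLevel i j) (A i j) (L i j)

    matVec-order : ∀ {A w} k → OrderAtLeastᴹ A → OrderAtLeastᵛ k w → OrderAtLeastᵛ (suc k) (matVec A w)
    matVec-order {A} {w} k A-ord w-ord i = order-sumFin (λ j → A i j *ₗ w j) λ j →
      ≡.subst (λ T → OrderAtLeast T (A i j *ₗ w j)) (entryLevel-step k i j) (order-* (A-ord i j) (w-ord j))

    matVec-leading : ∀ {A L w u} k → OrderAtLeastᴹ A → LeadingCoeffᴹ A L → OrderAtLeastᵛ k w → LeadingCoeffᵛ k w u
                   → LeadingCoeffᵛ (suc k) (matVec A w) (matVecᴷ L u)
    matVec-leading {A} {L} {w} {u} k A-ord A-lead w-ord w-lead i = leading-sumFin (λ j → A i j *ₗ w j) (λ j → L i j * u j) λ j →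
      ≡.subst (λ T → LeadingCoeff T (A i j *ₗ w j) (L i j * u j)) (entryLevel-step k i j)
        (leading-* (A-ord i j) (w-ord j) (A-lead i j) (w-lead j))

    connection-order : ∀ {A E w} k → OrderAtLeastᴹ A → PreservesOrder E → OrderAtLeastᵛ k w
                     → OrderAtLeastᵛ (suc k) (connection A E w)
    connection-order k A-ord E-ord w-ord i =
      order-+ (matVec-order k A-ord w-ord i) (order-mono (ℤₚ.<⇒≤ (level-< (ℕₚ.n<1+n k) i)) (E-ord _ _ (w-ord i)))

    connection-leading : ∀ {A L E w u} k → OrderAtLeastᴹ A → LeadingCoeffᴹ A L → PreservesOrder E
                       → OrderAtLeastᵛ k w → LeadingCoeffᵛ k w u → LeadingCoeffᵛ (suc k) (connection A E w) (matVecᴷ L u)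
    connection-leading k A-ord A-lead E-ord w-ord w-lead i = leading-resp (+-identityʳ _)
      (leading-+ (matVec-leading k A-ord A-lead w-ord w-lead i) (order⇒leading-0 (level-< (ℕₚ.n<1+n k) i) (E-ord _ _ (w-ord i))))

    e₀ : LVec r
    e₀ fzero    = 1ₗ
    e₀ (fsuc _) = 0ₗ

    e₀-order : OrderAtLeastᵛ 0 e₀
    e₀-order fzero    = order-1ₗ
    e₀-order (fsuc _) = order-0ₗ _

    e₀-leading : LeadingCoeffᵛ 0 e₀ (basisᴷ 0)
    e₀-leading fzero    = leading-1ₗ
    e₀-leading (fsuc _) = leading-0ₗ _

    iterate-connection : ∀ {A L E} → OrderAtLeastᴹ A → LeadingCoeffᴹ A L → PreservesOrder E → ∀ k
      → OrderAtLeastᵛ k (iterate (connection A E) k e₀)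
      × LeadingCoeffᵛ k (iterate (connection A E) k e₀) (iterate (matVecᴷ L) k (basisᴷ 0))
    iterate-connection A-ord A-lead E-ord zero    = e₀-order , e₀-leading
    iterate-connection A-ord A-lead E-ord (suc k) with iterate-connection A-ord A-lead E-ord k
    ... | w-ord , w-lead = connection-order k A-ord E-ord w-ord , connection-leading k A-ord A-lead E-ord w-ord w-lead

    -- ∇(E^p) e₀ has order ≥ level 1, strictly above level p where ∇(E)^p e₀ has leading coefficients L^p e₀.
    commuting⇒leading-power-vanishes : ∀ {A L E} → OrderAtLeastᴹ A → LeadingCoeffᴹ A L → PreservesOrder E
      → ∀ p → 1 < p → (∀ v → iterate (connection A E) p v ≋ connection A (iterate E p) v)
      → Vanishes (iterate (matVecᴷ L) p (basisᴷ 0))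
    commuting⇒leading-power-vanishes A-ord A-lead E-ord p 1<p commute i = leading-unique
      (leading-cong (commute e₀ i) (proj₂ (iterate-connection A-ord A-lead E-ord p) i))
      (order⇒leading-0 (level-< 1<p i) (connection-order 0 A-ord (iterate-preservesOrder E-ord p) e₀-order i))

    companion-order : ∀ {f} → (∀ i → OrderAtLeast (entryLevel i last) (f i)) → OrderAtLeastᴹ (companion r f)
    companion-order {f} f-ord i j with toℕ j ≡ᵇ r′ in e | toℕ i ≡ᵇ suc (toℕ j) in e′
    ... | true  | _     = ≡.subst (λ j → OrderAtLeast (entryLevel i j) (f i)) (≡.sym (is-last {j = j} e)) (f-ord i)
    ... | false | true  =
      ≡.subst (λ T → OrderAtLeast T 1ₗ) (≡.sym (entryLevel-subdiagonal {i} {j} (≡ᵇ-true {toℕ i} e′))) order-1ₗ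
    ... | false | false = order-0ₗ _

    companion-leading : ∀ {f c} → (∀ i → LeadingCoeff (entryLevel i last) (f i) (c i))
                      → LeadingCoeffᴹ (companion r f) (companionᴷ c)
    companion-leading {f} {c} f-lead i j with toℕ j ≡ᵇ r′ in e | toℕ i ≡ᵇ suc (toℕ j) in e′
    ... | true  | _     = ≡.subst (λ j → LeadingCoeff (entryLevel i j) (f i) (c i)) (≡.sym (is-last {j = j} e)) (f-lead i)
    ... | false | true  =
      ≡.subst (λ T → LeadingCoeff T 1ₗ 1#) (≡.sym (entryLevel-subdiagonal {i} {j} (≡ᵇ-true {toℕ i} e′))) leading-1ₗ
    ... | false | false = leading-0ₗ _

    companion-connection-noncommuting : IsField → ∀ {f c E}
      → (∀ i → OrderAtLeast (entryLevel i last) (f i)) → (∀ i → LeadingCoeff (entryLevel i last) (f i) (c i))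
      → ¬ Vanishes c → PreservesOrder E → ∀ p → 1 < p
      → ¬ (∀ v → iterate (connection (companion r f) E) p v ≋ connection (companion r f) (iterate E p) v)
    companion-connection-noncommuting isField {c = c} f-ord f-lead c≉0 E-ord p 1<p commute =
      companionᴷ-not-nilpotent isField c c≉0 p
        (commuting⇒leading-power-vanishes (companion-order f-ord) (companion-leading f-lead) E-ord p 1<p commute)

module NewtonPolygon {a ℓ} (K : CommutativeRing a ℓ) where
  open CommutativeRing K renaming (Carrier to C)
  open Over K
  open import Relation.Binary.Reasoning.Setoid setoid
  open LaurentCoefficients K
  open CompanionAlgebra K

  -- The steepest slope S/R of the Newton polygon of the companion polynomial: every f i has q-adic
  -- order at least -(r - i)·S/R, with equality at a vertex.
  record NewtonSlope {r′} (f : Fin (suc r′) → Laurent) : Set (a ⊔ ℓ) where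
    field
      R S            : ℕ
      {{R≢0}}        : NonZero R
      {{S≢0}}        : NonZero S
      bound          : ∀ i → WeightedOrder.OrderAtLeast K R (ℤ.- + (suc (r′ ∸ toℕ i) ℕ.* S)) (f i)
      vertex         : Fin (suc r′)
      vertexExponent : ℤ
      vertex-level   : ℤ.- + (suc (r′ ∸ toℕ vertex) ℕ.* S) ≡ vertexExponent ℤ.* + R
      vertex-coeff≉0 : ¬ coeff (f vertex) vertexExponent ≈ 0#

  pole-order : ∀ x → (∀ t → Dec (coeff x -[1+ t ] ≈ 0#))
             → ∃ λ n → (∀ t → n ≤ t → coeff x -[1+ t ] ≈ 0#) × (∀ u → n ≡ suc u → ¬ coeff x -[1+ u ] ≈ 0#)
  pole-order x dec = least-tail-bound dec (den x) λ t d≤t → reflexive (negCoeff-beyond (den x) (ser x) t d≤t)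

  newtonSlope : ∀ {r′} (f : Fin (suc r′) → Laurent) → (∀ i t → Dec (coeff (f i) -[1+ t ] ≈ 0#))
              → (∃ λ i → ∃ λ t → ¬ coeff (f i) -[1+ t ] ≈ 0#) → NewtonSlope f
  newtonSlope {r′} f dec (i* , t* , f-i*-t*≉0) = record
    { R = r ! ; S = S ; S≢0 = S≢0 ; bound = bound
    ; vertex = i₁ ; vertexExponent = -[1+ proj₁ vertex-pole ]
    ; vertex-level = vertex-level ; vertex-coeff≉0 = at-pole (proj₂ vertex-pole) }
    where
    r : ℕ
    r = suc r′
    instance
      r!≢0 : NonZero (r !)
      r!≢0 = r !≢0

    gap : Fin r → ℕ
    gap i = suc (r′ ∸ toℕ i)

    gap∣r! : ∀ i → gap i ∣ r !
    gap∣r! i = suc[n∸k]∣[1+n]! r′ (toℕ i)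

    q : Fin r → ℕ
    q i = _∣_.quotient (gap∣r! i)

    pole : Fin r → ℕ
    pole i = proj₁ (pole-order (f i) (dec i))

    beyond-pole : ∀ i t → pole i ≤ t → coeff (f i) -[1+ t ] ≈ 0#
    beyond-pole i = proj₁ (proj₂ (pole-order (f i) (dec i)))

    at-pole : ∀ {i u} → pole i ≡ suc u → ¬ coeff (f i) -[1+ u ] ≈ 0#
    at-pole {i} {u} = proj₂ (proj₂ (pole-order (f i) (dec i))) u

    w : Fin r → ℕ
    w i = pole i ℕ.* q i

    i₁ : Fin r
    i₁ = proj₁ (argmax w)

    S : ℕ
    S = w i₁

    w≤S : ∀ i → w i ≤ S
    w≤S = proj₂ (argmax w)

    pole*r!≡gap*w : ∀ i → pole i ℕ.* r ! ≡ gap i ℕ.* w i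
    pole*r!≡gap*w i = ≡.trans (cong (pole i ℕ.*_) (_∣_.equality (gap∣r! i)))
      (≡.trans (≡.sym (ℕₚ.*-assoc (pole i) (q i) (gap i))) (ℕₚ.*-comm (w i) (gap i)))

    S≢0 : NonZero S
    S≢0 = ℕ.>-nonZero (ℕₚ.<-≤-trans (ℕₚ.n≢0⇒n>0 w-i*≢0) (w≤S i*))
      where
      w-i*≢0 : w i* ≢ 0
      w-i*≢0 w≡0 with ℕₚ.m*n≡0⇒m≡0∨n≡0 (pole i*) w≡0
      ... | inj₁ pole≡0 = f-i*-t*≉0 (beyond-pole i* t* (≡.subst (_≤ t*) (≡.sym pole≡0) z≤n))
      ... | inj₂ q≡0    = ℕ.≢-nonZero⁻¹ (r !) (≡.trans (_∣_.equality (gap∣r! i*)) (cong (ℕ._* gap i*) q≡0))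

    vertex-pole : ∃ λ u → pole i₁ ≡ suc u
    vertex-pole with pole i₁ in e
    ... | suc u = u , ≡.refl
    ... | zero  = contradiction (cong (ℕ._* q i₁) e) (ℕ.≢-nonZero⁻¹ S {{S≢0}})

    vertex-level : ℤ.- + (gap i₁ ℕ.* S) ≡ -[1+ proj₁ vertex-pole ] ℤ.* + (r !)
    vertex-level = ≡.sym (≡.trans (neg-suc-*-pos (proj₁ vertex-pole) (r !))
      (≡.trans (cong (λ n → ℤ.- + (n ℕ.* r !)) (≡.sym (proj₂ vertex-pole))) (cong (λ n → ℤ.- + n) (pole*r!≡gap*w i₁))))

    bound : ∀ i → WeightedOrder.OrderAtLeast K (r !) (ℤ.- + (gap i ℕ.* S)) (f i)
    bound i (+ n) nR<-gS = contradiction (ℤₚ.<-≤-trans nR<-gS ℤₚ.neg-≤-pos) (ℤₚ.<-irrefl (≡.sym (ℤₚ.pos-* n (r !))))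
    bound i -[1+ t ] lt = beyond-pole i t (ℕₚ.m<1+n⇒m≤n (ℕₚ.*-cancelʳ-< (r !) (pole i) (suc t) poleR<[1+t]R))
      where
      gS<[1+t]R : gap i ℕ.* S < suc t ℕ.* r !
      gS<[1+t]R = ℤₚ.drop‿+<+ (ℤₚ.neg-cancel-< (≡.subst (ℤ._< _) (neg-suc-*-pos t (r !)) lt))
      poleR<[1+t]R : pole i ℕ.* r ! < suc t ℕ.* r !
      poleR<[1+t]R = ℕₚ.≤-<-trans (ℕₚ.≤-reflexive (pole*r!≡gap*w i))
                                  (ℕₚ.≤-<-trans (ℕₚ.*-monoʳ-≤ (gap i) (w≤S i)) gS<[1+t]R)

  -- Beyond den x the negative coefficients vanish, so only finitely many decisions are needed.
  negative-coeffs-decidable : ∀ {n} (f : Fin n → Laurent) → ¬ ¬ (∀ i t → Dec (coeff (f i) -[1+ t ] ≈ 0#))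
  negative-coeffs-decidable f k =
    ¬¬-Π-Fin (λ i → ¬¬-Π-Fin {P = λ t → Dec (coeff (f i) -[1+ toℕ t ] ≈ 0#)} (λ _ → ¬¬-excluded-middle))
      λ dec → k λ i t → decide i t (dec i)
    where
    decide : ∀ i t → (∀ (t′ : Fin (den (f i))) → Dec (coeff (f i) -[1+ toℕ t′ ] ≈ 0#)) → Dec (coeff (f i) -[1+ t ] ≈ 0#)
    decide i t dec with t ℕ.<? den (f i)
    ... | yes t<d = ≡.subst (λ t → Dec (coeff (f i) -[1+ t ] ≈ 0#)) (Finₚ.toℕ-fromℕ< t<d) (dec (fromℕ< t<d))
    ... | no t≮d  = yes (reflexive (negCoeff-beyond (den (f i)) (ser (f i)) t (ℕₚ.≮⇒≥ t≮d)))

  negative-entry : ∀ {r′} (f : Fin (suc r′) → Laurent) i j → NegativeValuation (companion (suc r′) f i j)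
                 → ∃ λ t → ¬ coeff (f i) -[1+ t ] ≈ 0#
  negative-entry f i j (+ _ , ℤ.+<+ () , _)
  negative-entry {r′} f i j (-[1+ t ] , _ , coeff≉0) with toℕ j ≡ᵇ r′ | toℕ i ≡ᵇ suc (toℕ j)
  ... | true  | _     = t , coeff≉0
  ... | false | true  = contradiction refl coeff≉0
  ... | false | false = contradiction refl coeff≉0

  polar-companion-noncommuting : IsField → ∀ {D} → QIntegral D → ∀ {r′} (f : Fin (suc r′) → Laurent)
    → (∃ λ i → ∃ λ t → ¬ coeff (f i) -[1+ t ] ≈ 0#) → ∀ p → 1 < p
    → ¬ (∀ v → iterate (connection (companion (suc r′) f) (extend D)) p v
               ≋ connection (companion (suc r′) f) (iterate (extend D) p) v)
  polar-companion-noncommuting isField {D} D-integral {r′} f pole p 1<p commute =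
    negative-coeffs-decidable f λ dec → from-slope (newtonSlope f dec pole)
    where
    from-slope : NewtonSlope f → ⊥
    from-slope slope = companion-connection-noncommuting isField f-order (proj₂ ∘ leading) lead≉0
                         (extend-preservesOrder D-integral) p 1<p commute
      where
      open NewtonSlope slope
      open WeightedOrder K R
      open Graded S r′
      f-order : ∀ i → OrderAtLeast (entryLevel i last) (f i)
      f-order i = ≡.subst (λ T → OrderAtLeast T (f i)) (≡.sym (entryLevel-last i)) (bound i)
      leading : ∀ i → ∃ (LeadingCoeff (entryLevel i last) (f i))
      leading i = leading-exists (entryLevel i last) (f i)
      lead≉0 : ¬ Vanishes (proj₁ ∘ leading)
      lead≉0 vanishes = vertex-coeff≉0 (trans (proj₁ (proj₂ (leading vertex)) vertexExponent
                          (≡.trans (entryLevel-last vertex) vertex-level)) (vanishes vertex))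

proposition3p6 : ∀ {c ℓ b} (K : CommutativeRing c ℓ) → let open Over K in
    (p : ℕ) → Prime p → (r : ℕ) → 1 ≤ r → r < p →
    IsField → HasCharacteristic p →
    (B : CommutativeRing.Carrier K → Set b) → IsSubfield B →
    (D : PS → PS) → IsDerivationOver B D → QIntegral D →
    (∀ s → iterate D p s ≈ₚ D s) →
    (f : Fin r → Laurent) →
    (∃ λ i → ∃ λ j → NegativeValuation (companion r f i j)) →
    ¬ (∀ v → iterate (connection (companion r f) (extend D)) p v
               ≋ connection (companion r f) (iterate (extend D) p) v)
proposition3p6 K p p-prime zero     () _ _ _ _ _ _ _ _ _ _ _
proposition3p6 K p p-prime (suc r′) _ _ isField _ _ _ D _ D-integral _ f (i , j , negative) =
  polar-companion-noncommuting isField D-integral f (i , negative-entry f i j negative)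
    p (ℕ.nonTrivial⇒n>1 p {{prime⇒nonTrivial p-prime}})
  where open NewtonPolygon K using (polar-companion-noncommuting; negative-entry)
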